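{- $\mathsf{VFU}\vdash\forall u,v\,[\mathrm C(u)\wedge\mathrm C(v)\to\mathrm U(\mathsf l_{u,v})\wedge u\sqsubset\mathsf l_{u,v}\wedge v\sqsubset\mathsf l_{u,v}]$, where $\mathsf l_{u,v}:=\mathsf l(u\oplus v)$ with $u\oplus v:=\lambda x.\,\dot{(\mathrm N((x)_0)\to\mathrm T(\mathsf d_\mathsf N(u(x)_1)(v(x)_1)((x)_0)\mathsf 0))}$.
   Context: $\mathsf{TON}$ is the total applicative theory in $\mathcal L$ (constants $\mathsf{k},\mathsf{s},\mathsf{p},\mathsf{p}_0,\mathsf{p}_1,\mathsf{0},\mathsf{s}_\mathsf{N},\mathsf{p}_\mathsf{N},\mathsf{d}_\mathsf{N}$, application, predicate $\mathrm N$; $(x,y):=\mathsf pxy$, $(x)_i:=\mathsf p_ix$; $\mathsf d_\mathsf Nuvab=u$ if $a,b$ are equal natural numbers, $=v$ if they are distinct natural numbers) with induction on $\mathrm N$ and $\lambda$-abstraction. $\mathcal L_{FS}$ adds constants $\dot=,\dot\neg,\dot\wedge,\dot\to,\dot\forall,\dot{\mathsf N},\dot{\mathsf T},\mathsf l$ and predicates $\mathrm T,\mathrm U$. Terms $\dot A$: $\dot{(s=t)}:=\dot=(s,t)$, $\dot{\mathrm N(s)}:=\dot{\mathsf N}s$, $\dot{\mathrm T(s)}:=\dot{\mathsf T}s$, $\dot{(\neg A)}:=\dot\neg\dot A$, $\dot{(A\wedge B)}:=\dot\wedge(\dot A,\dot B)$, $\dot{(A\to B)}:=\dot\to(\dot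 A,\dot B)$, $\dot{(\forall xA)}:=\dot\forall(\lambda x.\dot A)$. $\mathrm C(f):=\forall x(\mathrm T(fx)\vee\mathrm T(\dot\neg(fx)))$; $f\sqsubset g:=\forall x(\mathrm T(fx)\to\mathrm T(g(fx)))\wedge\forall x(\mathrm T(\dot\neg(fx))\to\mathrm T(g(\dot\neg(fx))))$. $\mathsf{VFU}$: $\mathsf{TON}$ and, for $\mathrm U(u)$ and all $\mathcal L_{FS}$-formulas $A,B$: $\mathrm T(u\dot A)\to A$; $P\to\mathrm T(u\dot P)$ for $\mathcal L$-literals $P$; $\mathrm T(u\,\dot{(A\to B)})\to(\mathrm T(u\dot A)\to\mathrm T(u\dot B))$; $\forall x\,\mathrm T(u\dot A)\to\mathrm T(u\,\dot{(\forall xA)})$; $\mathrm T(u\dot C)$ for each logically valid $C$; $\neg(\mathrm T(ux)\wedge\mathrm T(u(\dot\neg x)))$; $[\mathrm T(ux)\leftrightarrow\mathrm T(u(\dot{\mathsf T}x))]\wedge[\mathrm T(u(\dot\neg x))\leftrightarrow\mathrm T(u(\dot\neg(\dot{\mathsf T}x)))]$; $\mathrm C(u)$; $\mathrm T(ux)\to\mathrm T(x)$; $\mathrm C(f)\to\mathrm U(\mathsf lf)\wedge f\sqsubset\mathsf lf$. -}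

module Defs where

-- Deep embedding of the language L_FS, classical first-order logic with
-- equality (Hilbert style, de Bruijn variables), and the theory VFU.

open import Data.Nat using (ℕ; zero; suc)
open import Data.Bool using (Bool; true; false; _∨_; if_then_else_)
open import Data.Empty using (⊥)
open import Function using (_∘_)

data Const : Set where
  cK cS cP cP0 cP1 cZero cSN cPN cDN : Const
  cEq cNeg cAnd cImp cAll cN cT cL : Const

data Tm : Set where
  var : ℕ → Tm
  con : Const → Tm
  _·_ : Tm → Tm → Tm

infixl 9 _·_

k s p p₀ p₁ 𝟘 sN pN dN : Tm
k = con cK
s = con cS
p = con cP
p₀ = con cP0
p₁ = con cP1
𝟘 = con cZero
sN = con cSN
pN = con cPN
dN = con cDN

=̇ ¬̇ ∧̇ →̇ ∀̇ Ṅ Ṫ 𝕝 : Tm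
=̇ = con cEq
¬̇ = con cNeg
∧̇ = con cAnd
→̇ = con cImp
∀̇ = con cAll
Ṅ = con cN
Ṫ = con cT
𝕝 = con cL

⟨_,_⟩ : Tm → Tm → Tm
⟨ a , b ⟩ = p · a · b

subT : (ℕ → Tm) → Tm → Tm
subT σ (var n) = σ n
subT σ (con c) = con c
subT σ (a · b) = subT σ a · subT σ b

shift : Tm → Tm
shift = subT (var ∘ suc)

ext : (ℕ → Tm) → ℕ → Tm
ext σ zero = var zero
ext σ (suc n) = shift (σ n)

-- λ-abstraction (combinatory, as in TON) of the variable 0:
--   λx.x = s k k,  λx.t = k t  if x does not occur in t,
--   λx.(a b) = s (λx.a) (λx.b).

occ0 : Tm → Bool
occ0 (var zero) = true
occ0 (var (suc n)) = false
occ0 (con c) = false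
occ0 (a · b) = occ0 a ∨ occ0 b

down : ℕ → Tm
down zero = var zero       -- irrelevant: only used on terms not containing var 0
down (suc n) = var n

lam : Tm → Tm
lam (var zero) = s · k · k
lam (var (suc n)) = k · var n
lam (con c) = k · con c
lam (a · b) = if occ0 (a · b) then s · lam a · lam b else k · subT down (a · b)

data Fm : Set where
  _≐_ : Tm → Tm → Fm
  N T U : Tm → Fm
  ¬' : Fm → Fm
  _∧'_ _⇒_ : Fm → Fm → Fm
  ∀' : Fm → Fm          -- binds de Bruijn variable 0

infix 6 _≐_
infixr 4 _∧'_
infixr 3 _⇒_

_∨'_ : Fm → Fm → Fm
A ∨' B = ¬' A ⇒ B

_⇔_ : Fm → Fm → Fm
A ⇔ B = (A ⇒ B) ∧' (B ⇒ A)

subF : (ℕ → Tm) → Fm → Fm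
subF σ (a ≐ b) = subT σ a ≐ subT σ b
subF σ (N a) = N (subT σ a)
subF σ (T a) = T (subT σ a)
subF σ (U a) = U (subT σ a)
subF σ (¬' A) = ¬' (subF σ A)
subF σ (A ∧' B) = subF σ A ∧' subF σ B
subF σ (A ⇒ B) = subF σ A ⇒ subF σ B
subF σ (∀' A) = ∀' (subF (ext σ) A)

shiftF : Fm → Fm
shiftF = subF (var ∘ suc)

sub0 : Tm → ℕ → Tm
sub0 t zero = t
sub0 t (suc n) = var n

_[_] : Fm → Tm → Fm
A [ t ] = subF (sub0 t) A

-- Codes Ȧ: defined for formulas not containing U.

data UFree : Fm → Set where
  eq  : ∀ a b → UFree (a ≐ b)
  nat : ∀ a → UFree (N a)
  tr  : ∀ a → UFree (T a)
  neg : ∀ {A} → UFree A → UFree (¬' A)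
  and : ∀ {A B} → UFree A → UFree B → UFree (A ∧' B)
  imp : ∀ {A B} → UFree A → UFree B → UFree (A ⇒ B)
  all : ∀ {A} → UFree A → UFree (∀' A)

dot : (A : Fm) → UFree A → Tm
dot (a ≐ b) _ = =̇ · ⟨ a , b ⟩
dot (N a) _ = Ṅ · a
dot (T a) _ = Ṫ · a
dot (¬' A) (neg h) = ¬̇ · dot A h
dot (A ∧' B) (and h h') = ∧̇ · ⟨ dot A h , dot B h' ⟩
dot (A ⇒ B) (imp h h') = →̇ · ⟨ dot A h , dot B h' ⟩
dot (∀' A) (all h) = ∀̇ · lam (dot A h)

data IsL : Fm → Set where
  eq  : ∀ a b → IsL (a ≐ b)
  nat : ∀ a → IsL (N a)
  neg : ∀ {A} → IsL A → IsL (¬' A)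
  and : ∀ {A B} → IsL A → IsL B → IsL (A ∧' B)
  imp : ∀ {A B} → IsL A → IsL B → IsL (A ⇒ B)
  all : ∀ {A} → IsL A → IsL (∀' A)

data LLit : Fm → Set where
  eq    : ∀ a b → LLit (a ≐ b)
  nat   : ∀ a → LLit (N a)
  neqt  : ∀ a b → LLit (¬' (a ≐ b))
  nnat  : ∀ a → LLit (¬' (N a))

data Prf (Ax : Fm → Set) : Fm → Set where
  ax   : ∀ {A} → Ax A → Prf Ax A
  mp   : ∀ {A B} → Prf Ax (A ⇒ B) → Prf Ax A → Prf Ax B
  gen  : ∀ {A} → Prf Ax A → Prf Ax (∀' A)
  l1   : ∀ A B → Prf Ax (A ⇒ B ⇒ A)
  l2   : ∀ A B C → Prf Ax ((A ⇒ B ⇒ C) ⇒ (A ⇒ B) ⇒ A ⇒ C)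
  l3   : ∀ A B → Prf Ax ((¬' A ⇒ ¬' B) ⇒ B ⇒ A)
  ∧i   : ∀ A B → Prf Ax (A ⇒ B ⇒ A ∧' B)
  ∧e₁  : ∀ A B → Prf Ax (A ∧' B ⇒ A)
  ∧e₂  : ∀ A B → Prf Ax (A ∧' B ⇒ B)
  ∀e   : ∀ A t → Prf Ax (∀' A ⇒ A [ t ])
  ∀d   : ∀ A B → Prf Ax (∀' (shiftF B ⇒ A) ⇒ B ⇒ ∀' A)
  refl≐ : ∀ t → Prf Ax (t ≐ t)
  subst≐ : ∀ A a b → Prf Ax (a ≐ b ⇒ A [ a ] ⇒ A [ b ])

Valid : Fm → Set
Valid = Prf (λ _ → ⊥)

C : Tm → Fm
C f = ∀' (T (shift f · var 0) ∨' T (¬̇ · (shift f · var 0)))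

_⊏_ : Tm → Tm → Fm
f ⊏ g = ∀' (T (shift f · var 0) ⇒ T (shift g · (shift f · var 0)))
     ∧' ∀' (T (¬̇ · (shift f · var 0)) ⇒ T (shift g · (¬̇ · (shift f · var 0))))

stepσ : ℕ → Tm
stepσ zero = sN · var zero
stepσ (suc n) = var (suc n)

data VFU : Fm → Set where
  kAx  : ∀ a b → VFU (k · a · b ≐ a)
  sAx  : ∀ a b c → VFU (s · a · b · c ≐ a · c · (b · c))
  p₀Ax : ∀ a b → VFU (p₀ · ⟨ a , b ⟩ ≐ a)
  p₁Ax : ∀ a b → VFU (p₁ · ⟨ a , b ⟩ ≐ b)
  N1a  : VFU (N 𝟘)
  N1b  : ∀ a → VFU (N a ⇒ N (sN · a))
  N2   : ∀ a → VFU (N a ⇒ ¬' (sN · a ≐ 𝟘) ∧' pN · (sN · a) ≐ a)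
  N3   : ∀ a → VFU (N a ∧' ¬' (a ≐ 𝟘) ⇒ N (pN · a) ∧' sN · (pN · a) ≐ a)
  DN1  : ∀ x y a b → VFU (N a ∧' N b ∧' a ≐ b ⇒ dN · x · y · a · b ≐ x)
  DN2  : ∀ x y a b → VFU (N a ∧' N b ∧' ¬' (a ≐ b) ⇒ dN · x · y · a · b ≐ y)
  Ind  : ∀ A → IsL A →
         VFU (A [ 𝟘 ] ∧' ∀' (N (var 0) ∧' A ⇒ subF stepσ A) ⇒ ∀' (N (var 0) ⇒ A))
  U-refl : ∀ u A (h : UFree A) → VFU (U u ⇒ T (u · dot A h) ⇒ A)
  U-lit  : ∀ u P (h : UFree P) → LLit P → VFU (U u ⇒ P ⇒ T (u · dot P h))
  U-imp  : ∀ u A B (h : UFree A) (h' : UFree B) →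
           VFU (U u ⇒ T (u · dot (A ⇒ B) (imp h h')) ⇒ T (u · dot A h) ⇒ T (u · dot B h'))
  U-all  : ∀ u A (h : UFree A) →
           VFU (U u ⇒ ∀' (T (shift u · dot A h)) ⇒ T (u · dot (∀' A) (all h)))
  U-valid : ∀ u C' (h : UFree C') → Valid C' → VFU (U u ⇒ T (u · dot C' h))
  U-cons : ∀ u x → VFU (U u ⇒ ¬' (T (u · x) ∧' T (u · (¬̇ · x))))
  U-T    : ∀ u x → VFU (U u ⇒ (T (u · x) ⇔ T (u · (Ṫ · x)))
                              ∧' (T (u · (¬̇ · x)) ⇔ T (u · (¬̇ · (Ṫ · x)))))
  U-C    : ∀ u → VFU (U u ⇒ C u)
  U-sub  : ∀ u x → VFU (U u ⇒ T (u · x) ⇒ T x)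
  L-ax   : ∀ f → VFU (C f ⇒ U (𝕝 · f) ∧' f ⊏ (𝕝 · f))

⊕body : Tm → Tm → Fm
⊕body u v = N (p₀ · var 0) ⇒
  T (dN · (shift u · (p₁ · var 0)) · (shift v · (p₁ · var 0)) · (p₀ · var 0) · 𝟘)

⊕body-UFree : ∀ u v → UFree (⊕body u v)
⊕body-UFree u v = imp (nat _) (tr _)

_⊕_ : Tm → Tm → Tm
u ⊕ v = lam (dot (⊕body u v) (⊕body-UFree u v))

𝕝[_,_] : Tm → Tm → Tm
𝕝[ u , v ] = 𝕝 · (u ⊕ v)

{-# OPTIONS --safe #-}
module Submission where

-- At (c, x) the function u ⊕ v returns the code of N c → T(d), where d is u x or v x
-- according to whether the number c is 0 (at (0, x) it is u x, at (1, x) it is v x).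
-- Such a code is decided: when c is not a number it is vacuously true, and otherwise
-- the universe l u (or l v), which decides u x and contains the literal N c, passes
-- that decision on to the code by its closure under valid implications.  So u ⊕ v is
-- classical, and l_{u,v} is a universe extending it.  Conversely, if u x is true
-- (false), so is the code at (0, x), which l_{u,v} therefore contains (negated);
-- together with the literal N 0 this puts u x (resp. ¬̇(u x)) into l_{u,v}.  That is
-- u ⊏ l_{u,v}, and likewise v ⊏ l_{u,v} at (1, x).

open import Defs
open import Data.Bool using (true; false)
open import Data.Bool.Properties using (∨-conicalˡ; ∨-conicalʳ)
open import Data.List using (List; []; _∷_)
open import Data.List.Membership.Propositional using (_∈_)
open import Data.List.Relation.Unary.Any using (here; there)
open import Data.Nat using (zero; suc)
open import Relation.Binary.PropositionalEquality using (_≡_; refl; cong; cong₂; subst)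

private variable
  A B P Q R : Fm
  Γ : List Fm
  a a′ b c d d′ f g t u v w x y z : Tm

subT-sub0-shift : ∀ t a → subT (sub0 t) (shift a) ≡ a
subT-sub0-shift t (var n) = refl
subT-sub0-shift t (con c) = refl
subT-sub0-shift t (a · b) = cong₂ _·_ (subT-sub0-shift t a) (subT-sub0-shift t b)

subT-down≡sub0 : ∀ a t → occ0 t ≡ false → subT down t ≡ subT (sub0 a) t
subT-down≡sub0 a (var zero) ()
subT-down≡sub0 a (var (suc n)) _ = refl
subT-down≡sub0 a (con c) _ = refl
subT-down≡sub0 a (t · t′) fresh =
  cong₂ _·_ (subT-down≡sub0 a t (∨-conicalˡ _ _ fresh))
            (subT-down≡sub0 a t′ (∨-conicalʳ _ _ fresh))

module Derivation (Ax : Fm → Set) where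

  infix  2 _⊢_
  infixl 5 _∙_

  data _⊢_ (Γ : List Fm) : Fm → Set where
    hyp : A ∈ Γ → Γ ⊢ A
    thm : Prf Ax A → Γ ⊢ A
    _∙_ : Γ ⊢ A ⇒ B → Γ ⊢ A → Γ ⊢ B

  assumption : A ∷ Γ ⊢ A
  assumption = hyp (here refl)

  weaken : Γ ⊢ A → B ∷ Γ ⊢ A
  weaken (hyp i) = hyp (there i)
  weaken (thm q) = thm q
  weaken (d ∙ e) = weaken d ∙ weaken e

  ⇒-refl : ∀ A → Prf Ax (A ⇒ A)
  ⇒-refl A = mp (mp (l2 A (A ⇒ A) A) (l1 A (A ⇒ A))) (l1 A A)

  ⇒-intro : A ∷ Γ ⊢ B → Γ ⊢ A ⇒ B
  ⇒-intro {A} (hyp (here refl)) = thm (⇒-refl A)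
  ⇒-intro (hyp (there i)) = thm (l1 _ _) ∙ hyp i
  ⇒-intro (thm q) = thm (l1 _ _) ∙ thm q
  ⇒-intro (d ∙ e) = thm (l2 _ _ _) ∙ ⇒-intro d ∙ ⇒-intro e

  close : [] ⊢ A → Prf Ax A
  close (hyp ())
  close (thm q) = q
  close (d ∙ e) = mp (close d) (close e)

  ∧-intro : Γ ⊢ A → Γ ⊢ B → Γ ⊢ A ∧' B
  ∧-intro h h′ = thm (∧i _ _) ∙ h ∙ h′

  ∧-elimˡ : Γ ⊢ A ∧' B → Γ ⊢ A
  ∧-elimˡ h = thm (∧e₁ _ _) ∙ h

  ∧-elimʳ : Γ ⊢ A ∧' B → Γ ⊢ B
  ∧-elimʳ h = thm (∧e₂ _ _) ∙ h

  ¬-elim : Γ ⊢ ¬' A → Γ ⊢ A → Γ ⊢ B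
  ¬-elim {A = A} {B = B} h h′ = thm (l3 B A) ∙ (thm (l1 _ _) ∙ h) ∙ h′

  ¬¬-elim : Γ ⊢ ¬' (¬' A) → Γ ⊢ A
  ¬¬-elim {A = A} h =
    thm (l3 A (¬' (¬' A))) ∙ (thm (l3 (¬' (¬' (¬' A))) (¬' A)) ∙ (thm (l1 _ _) ∙ h)) ∙ h

  ¬¬-intro : Γ ⊢ A → Γ ⊢ ¬' (¬' A)
  ¬¬-intro {A = A} h = thm (l3 (¬' (¬' A)) A) ∙ ⇒-intro (¬¬-elim assumption) ∙ h

  contrapose : Γ ⊢ A ⇒ B → Γ ⊢ ¬' B → Γ ⊢ ¬' A
  contrapose {A = A} {B = B} h h′ =
    thm (l3 (¬' A) (¬' B)) ∙ ⇒-intro (¬¬-intro (weaken h ∙ ¬¬-elim assumption)) ∙ h′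

  by-cases : ∀ A → A ∷ Γ ⊢ B → ¬' A ∷ Γ ⊢ B → Γ ⊢ B
  by-cases {B = B} A h h′ =
    thm (l3 B (A ⇒ A))
      ∙ ⇒-intro (¬-elim (contrapose (weaken (⇒-intro h′)) assumption)
                        (contrapose (weaken (⇒-intro h)) assumption))
      ∙ thm (⇒-refl A)

  ∨-introˡ : Γ ⊢ P → Γ ⊢ P ∨' Q
  ∨-introˡ h = ⇒-intro (¬-elim assumption (weaken h))

  ∨-introʳ : Γ ⊢ Q → Γ ⊢ P ∨' Q
  ∨-introʳ h = thm (l1 _ _) ∙ h

  ∨-elim : Γ ⊢ P ∨' Q → P ∷ Γ ⊢ R → Q ∷ Γ ⊢ R → Γ ⊢ R
  ∨-elim {P = P} h hP hQ = by-cases P hP (weaken (⇒-intro hQ) ∙ (weaken h ∙ assumption))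

  ≐-refl : Γ ⊢ a ≐ a
  ≐-refl = thm (refl≐ _)

  ≐-subst : ∀ A → A [ a ] ≡ P → A [ b ] ≡ Q → Γ ⊢ a ≐ b → Γ ⊢ P → Γ ⊢ Q
  ≐-subst A refl refl h h′ = thm (subst≐ A _ _) ∙ h ∙ h′

  ≐-sym : Γ ⊢ a ≐ b → Γ ⊢ b ≐ a
  ≐-sym {a = a} {b = b} h =
    ≐-subst (var 0 ≐ shift a)
      (cong (a ≐_) (subT-sub0-shift a a)) (cong (b ≐_) (subT-sub0-shift b a))
      h ≐-refl

  ≐-trans : Γ ⊢ a ≐ b → Γ ⊢ b ≐ c → Γ ⊢ a ≐ c
  ≐-trans {a = a} {b = b} {c = c} h h′ =
    ≐-subst (shift a ≐ var 0)
      (cong (_≐ b) (subT-sub0-shift b a)) (cong (_≐ c) (subT-sub0-shift c a))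
      h′ h

  ·-congˡ : Γ ⊢ a ≐ b → Γ ⊢ a · c ≐ b · c
  ·-congˡ {a = a} {b = b} {c = c} h =
    ≐-subst (shift (a · c) ≐ var 0 · shift c)
      (cong₂ _≐_ (subT-sub0-shift a (a · c)) (cong (a ·_) (subT-sub0-shift a c)))
      (cong₂ _≐_ (subT-sub0-shift b (a · c)) (cong (b ·_) (subT-sub0-shift b c)))
      h ≐-refl

  ·-congʳ : Γ ⊢ a ≐ b → Γ ⊢ c · a ≐ c · b
  ·-congʳ {a = a} {b = b} {c = c} h =
    ≐-subst (shift (c · a) ≐ shift c · var 0)
      (cong₂ _≐_ (subT-sub0-shift a (c · a)) (cong (_· a) (subT-sub0-shift a c)))
      (cong₂ _≐_ (subT-sub0-shift b (c · a)) (cong (_· b) (subT-sub0-shift b c)))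
      h ≐-refl

  ·-cong : Γ ⊢ a ≐ b → Γ ⊢ c ≐ d → Γ ⊢ a · c ≐ b · d
  ·-cong h h′ = ≐-trans (·-congˡ h) (·-congʳ h′)

  N-subst : Γ ⊢ a ≐ b → Γ ⊢ N a → Γ ⊢ N b
  N-subst = ≐-subst (N (var 0)) refl refl

  T-subst : Γ ⊢ a ≐ b → Γ ⊢ T a → Γ ⊢ T b
  T-subst = ≐-subst (T (var 0)) refl refl

  ∀-elim : ∀ {A} t → A [ t ] ≡ B → Γ ⊢ ∀' A → Γ ⊢ B
  ∀-elim t refl h = thm (∀e _ t) ∙ h

  ∀-intro : shiftF A ∷ [] ⊢ B → A ∷ [] ⊢ ∀' B
  ∀-intro h = thm (∀d _ _) ∙ thm (gen (close (⇒-intro h))) ∙ assumption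

explosion : ∀ {Ax} A B → Prf Ax (¬' A ⇒ A ⇒ B)
explosion {Ax} A B = close (⇒-intro (⇒-intro (¬-elim (weaken assumption) assumption)))
  where open Derivation Ax

⇒-refute : ∀ {Ax} A B → Prf Ax (A ⇒ ¬' B ⇒ ¬' (A ⇒ B))
⇒-refute {Ax} A B =
  close (⇒-intro (⇒-intro
    (contrapose (⇒-intro (assumption ∙ weaken (weaken assumption))) assumption)))
  where open Derivation Ax

¬⇒-consequent : ∀ {Ax} A B → Prf Ax (¬' (A ⇒ B) ⇒ ¬' B)
¬⇒-consequent {Ax} A B = close (⇒-intro (contrapose (thm (l1 B A)) assumption))
  where open Derivation Ax

open Derivation VFU

axiom : VFU A → Γ ⊢ A
axiom h = thm (ax h)

lam-β : ∀ t a → Γ ⊢ lam t · a ≐ subT (sub0 a) t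
lam-β (var zero) a = ≐-trans (axiom (sAx k k a)) (axiom (kAx a (k · a)))
lam-β (var (suc n)) a = axiom (kAx (var n) a)
lam-β (con c) a = axiom (kAx (con c) a)
lam-β {Γ} (t · t′) a with occ0 (t · t′) in occurs
... | true  = ≐-trans (axiom (sAx (lam t) (lam t′) a)) (·-cong (lam-β t a) (lam-β t′ a))
... | false = subst (λ r → Γ ⊢ k · subT down (t · t′) · a ≐ r)
                (subT-down≡sub0 a (t · t′) occurs) (axiom (kAx _ a))

N-𝟘 : Γ ⊢ N 𝟘
N-𝟘 = axiom N1a

N-1 : Γ ⊢ N (sN · 𝟘)
N-1 = axiom (N1b 𝟘) ∙ N-𝟘

1≢𝟘 : Γ ⊢ ¬' (sN · 𝟘 ≐ 𝟘)
1≢𝟘 = ∧-elimˡ (axiom (N2 𝟘) ∙ N-𝟘)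

p₀-pair : Γ ⊢ p₀ · ⟨ a , b ⟩ ≐ a
p₀-pair = axiom (p₀Ax _ _)

p₁-pair : Γ ⊢ p₁ · ⟨ a , b ⟩ ≐ b
p₁-pair = axiom (p₁Ax _ _)

dN-equal : Γ ⊢ N b → Γ ⊢ a ≐ b → Γ ⊢ dN · x · y · a · b ≐ x
dN-equal hb h = axiom (DN1 _ _ _ _) ∙ ∧-intro (N-subst (≐-sym h) hb) (∧-intro hb h)

dN-distinct : Γ ⊢ N a → Γ ⊢ N b → Γ ⊢ ¬' (a ≐ b) → Γ ⊢ dN · x · y · a · b ≐ y
dN-distinct ha hb h = axiom (DN2 _ _ _ _) ∙ ∧-intro ha (∧-intro hb h)

univ-sound : Γ ⊢ U z → Γ ⊢ T (z · x) → Γ ⊢ T x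
univ-sound hz h = axiom (U-sub _ _) ∙ hz ∙ h

univ-literal : (hP : UFree P) → LLit P → Γ ⊢ U z → Γ ⊢ P → Γ ⊢ T (z · dot P hP)
univ-literal hP lit hz h = axiom (U-lit _ _ hP lit) ∙ hz ∙ h

univ-mp : (hA : UFree A) (hB : UFree B) → Γ ⊢ U z →
          Γ ⊢ T (z · dot (A ⇒ B) (imp hA hB)) → Γ ⊢ T (z · dot A hA) → Γ ⊢ T (z · dot B hB)
univ-mp hA hB hz h h′ = axiom (U-imp _ _ _ hA hB) ∙ hz ∙ h ∙ h′

univ-closed : (hA : UFree A) (hB : UFree B) → Valid (A ⇒ B) → Γ ⊢ U z →
              Γ ⊢ T (z · dot A hA) → Γ ⊢ T (z · dot B hB)
univ-closed hA hB valid hz = univ-mp hA hB hz (axiom (U-valid _ _ (imp hA hB) valid) ∙ hz)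

univ-closed₂ : (hA : UFree A) (hB : UFree B) (hP : UFree P) → Valid (A ⇒ B ⇒ P) → Γ ⊢ U z →
               Γ ⊢ T (z · dot A hA) → Γ ⊢ T (z · dot B hB) → Γ ⊢ T (z · dot P hP)
univ-closed₂ hA hB hP valid hz h = univ-mp hB hP hz (univ-closed hA (imp hB hP) valid hz h)

univ-Ṫ-intro : Γ ⊢ U z → Γ ⊢ T (z · x) → Γ ⊢ T (z · (Ṫ · x))
univ-Ṫ-intro hz h = ∧-elimˡ (∧-elimˡ (axiom (U-T _ _) ∙ hz)) ∙ h

univ-Ṫ-elim : Γ ⊢ U z → Γ ⊢ T (z · (Ṫ · x)) → Γ ⊢ T (z · x)
univ-Ṫ-elim hz h = ∧-elimʳ (∧-elimˡ (axiom (U-T _ _) ∙ hz)) ∙ h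

univ-¬Ṫ-intro : Γ ⊢ U z → Γ ⊢ T (z · (¬̇ · x)) → Γ ⊢ T (z · (¬̇ · (Ṫ · x)))
univ-¬Ṫ-intro hz h = ∧-elimˡ (∧-elimʳ (axiom (U-T _ _) ∙ hz)) ∙ h

univ-¬Ṫ-elim : Γ ⊢ U z → Γ ⊢ T (z · (¬̇ · (Ṫ · x))) → Γ ⊢ T (z · (¬̇ · x))
univ-¬Ṫ-elim hz h = ∧-elimʳ (∧-elimʳ (axiom (U-T _ _) ∙ hz)) ∙ h

Decided : Tm → Fm
Decided x = T x ∨' T (¬̇ · x)

Decided-≐ : Γ ⊢ x ≐ y → Γ ⊢ Decided x → Γ ⊢ Decided y
Decided-≐ h hx = ∨-elim hx (∨-introˡ (T-subst (weaken h) assumption))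
                           (∨-introʳ (T-subst (·-congʳ (weaken h)) assumption))

C-elim : Γ ⊢ C f → Γ ⊢ Decided (f · t)
C-elim {f = f} {t = t} = ∀-elim t (cong (λ g → Decided (g · t)) (subT-sub0-shift t f))

⊏-elim : Γ ⊢ f ⊏ g → Γ ⊢ T (f · t) → Γ ⊢ T (g · (f · t))
⊏-elim {f = f} {g = g} {t = t} h h′ = ∀-elim t same (∧-elimˡ h) ∙ h′
  where
  same : (T (shift f · var 0) ⇒ T (shift g · (shift f · var 0))) [ t ]
         ≡ (T (f · t) ⇒ T (g · (f · t)))
  same rewrite subT-sub0-shift t f | subT-sub0-shift t g = refl

⊏-elim-¬ : Γ ⊢ f ⊏ g → Γ ⊢ T (¬̇ · (f · t)) → Γ ⊢ T (g · (¬̇ · (f · t)))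
⊏-elim-¬ {f = f} {g = g} {t = t} h h′ = ∀-elim t same (∧-elimʳ h) ∙ h′
  where
  same : (T (¬̇ · (shift f · var 0)) ⇒ T (shift g · (¬̇ · (shift f · var 0)))) [ t ]
         ≡ (T (¬̇ · (f · t)) ⇒ T (g · (¬̇ · (f · t))))
  same rewrite subT-sub0-shift t f | subT-sub0-shift t g = refl

⊏-intro : ∀ f g →
          T (shift f · var 0) ∷ shiftF A ∷ [] ⊢ T (shift g · (shift f · var 0)) →
          T (¬̇ · (shift f · var 0)) ∷ shiftF A ∷ [] ⊢ T (shift g · (¬̇ · (shift f · var 0))) →
          A ∷ [] ⊢ f ⊏ g
⊏-intro f g h h′ = ∧-intro (∀-intro (⇒-intro h)) (∀-intro (⇒-intro h′))

𝕝-universe : ∀ f → Γ ⊢ C f → Γ ⊢ U (𝕝 · f)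
𝕝-universe f h = ∧-elimˡ (axiom (L-ax f) ∙ h)

𝕝-extends : ∀ f → Γ ⊢ C f → Γ ⊢ f ⊏ (𝕝 · f)
𝕝-extends f h = ∧-elimʳ (axiom (L-ax f) ∙ h)

⌜N_⇒T_⌝ : Tm → Tm → Tm
⌜N a ⇒T d ⌝ = dot (N a ⇒ T d) (imp (nat a) (tr d))

⌜⇒T⌝-cong : Γ ⊢ a ≐ a′ → Γ ⊢ d ≐ d′ → Γ ⊢ ⌜N a ⇒T d ⌝ ≐ ⌜N a′ ⇒T d′ ⌝
⌜⇒T⌝-cong ha hd = ·-congʳ (·-cong (·-congʳ (·-congʳ ha)) (·-congʳ hd))

univ-⇒T-intro : Γ ⊢ U z → Γ ⊢ T (z · d) → Γ ⊢ T (z · ⌜N a ⇒T d ⌝)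
univ-⇒T-intro hz h = univ-closed (tr _) (imp (nat _) (tr _)) (l1 _ _) hz (univ-Ṫ-intro hz h)

univ-⇒T-vacuous : Γ ⊢ U z → Γ ⊢ ¬' (N a) → Γ ⊢ T (z · ⌜N a ⇒T d ⌝)
univ-⇒T-vacuous hz h =
  univ-closed (neg (nat _)) (imp (nat _) (tr _)) (explosion _ _) hz
    (univ-literal (neg (nat _)) (nnat _) hz h)

univ-⇒T-elim : Γ ⊢ U z → Γ ⊢ N a → Γ ⊢ T (z · ⌜N a ⇒T d ⌝) → Γ ⊢ T (z · d)
univ-⇒T-elim hz ha h =
  univ-Ṫ-elim hz (univ-mp (nat _) (tr _) hz h (univ-literal (nat _) (nat _) hz ha))

univ-¬⇒T-intro : Γ ⊢ U z → Γ ⊢ N a → Γ ⊢ T (z · (¬̇ · d)) →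
                 Γ ⊢ T (z · (¬̇ · ⌜N a ⇒T d ⌝))
univ-¬⇒T-intro hz ha h =
  univ-closed₂ (nat _) (neg (tr _)) (neg (imp (nat _) (tr _))) (⇒-refute _ _) hz
    (univ-literal (nat _) (nat _) hz ha) (univ-¬Ṫ-intro hz h)

univ-¬⇒T-elim : Γ ⊢ U z → Γ ⊢ T (z · (¬̇ · ⌜N a ⇒T d ⌝)) → Γ ⊢ T (z · (¬̇ · d))
univ-¬⇒T-elim hz h =
  univ-¬Ṫ-elim hz (univ-closed (neg (imp (nat _) (tr _))) (neg (tr _)) (¬⇒-consequent _ _) hz h)

⌜⇒T⌝-true : Γ ⊢ C f → Γ ⊢ T (f · b) → Γ ⊢ T ⌜N a ⇒T f · b ⌝
⌜⇒T⌝-true {f = f} hf h =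
  univ-sound (𝕝-universe f hf)
    (univ-⇒T-intro (𝕝-universe f hf) (⊏-elim (𝕝-extends f hf) h))

⌜⇒T⌝-false : Γ ⊢ C f → Γ ⊢ N a → Γ ⊢ T (¬̇ · (f · b)) → Γ ⊢ T (¬̇ · ⌜N a ⇒T f · b ⌝)
⌜⇒T⌝-false {f = f} hf ha h =
  univ-sound (𝕝-universe f hf)
    (univ-¬⇒T-intro (𝕝-universe f hf) ha (⊏-elim-¬ (𝕝-extends f hf) h))

⌜⇒T⌝-decided : Γ ⊢ C f → Γ ⊢ N a → Γ ⊢ d ≐ f · b → Γ ⊢ Decided ⌜N a ⇒T d ⌝
⌜⇒T⌝-decided hf ha hd =
  Decided-≐ (⌜⇒T⌝-cong ≐-refl (≐-sym hd))
    (∨-elim (C-elim hf) (∨-introˡ (⌜⇒T⌝-true (weaken hf) assumption))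
                        (∨-introʳ (⌜⇒T⌝-false (weaken hf) (weaken ha) assumption)))

𝕝-extends-branch : Γ ⊢ C f → Γ ⊢ C w → Γ ⊢ N a → Γ ⊢ w · y ≐ ⌜N a ⇒T f · x ⌝ →
                   Γ ⊢ T (f · x) → Γ ⊢ T (𝕝 · w · (f · x))
𝕝-extends-branch {w = w} hf hw ha hy h =
  univ-⇒T-elim (𝕝-universe w hw) ha
    (T-subst (·-congʳ hy)
      (⊏-elim (𝕝-extends w hw) (T-subst (≐-sym hy) (⌜⇒T⌝-true hf h))))

𝕝-extends-¬branch : Γ ⊢ C f → Γ ⊢ C w → Γ ⊢ N a → Γ ⊢ w · y ≐ ⌜N a ⇒T f · x ⌝ →
                    Γ ⊢ T (¬̇ · (f · x)) → Γ ⊢ T (𝕝 · w · (¬̇ · (f · x)))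
𝕝-extends-¬branch {w = w} hf hw ha hy h =
  univ-¬⇒T-elim (𝕝-universe w hw)
    (T-subst (·-congʳ (·-congʳ hy))
      (⊏-elim-¬ (𝕝-extends w hw) (T-subst (·-congʳ (≐-sym hy)) (⌜⇒T⌝-false hf ha h))))

⊕-select : Tm → Tm → Tm → Tm
⊕-select u v y = dN · (u · (p₁ · y)) · (v · (p₁ · y)) · (p₀ · y) · 𝟘

⊕-β : ∀ u v y → Γ ⊢ (u ⊕ v) · y ≐ ⌜N p₀ · y ⇒T ⊕-select u v y ⌝
⊕-β {Γ} u v y =
  subst (λ r → Γ ⊢ (u ⊕ v) · y ≐ r) body-at-y
    (lam-β (dot (⊕body u v) (⊕body-UFree u v)) y)
  where
  body-at-y : subT (sub0 y) (dot (⊕body u v) (⊕body-UFree u v))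
              ≡ ⌜N p₀ · y ⇒T ⊕-select u v y ⌝
  body-at-y rewrite subT-sub0-shift y u | subT-sub0-shift y v = refl

⊕-at-𝟘 : ∀ u v → Γ ⊢ (u ⊕ v) · ⟨ 𝟘 , x ⟩ ≐ ⌜N 𝟘 ⇒T u · x ⌝
⊕-at-𝟘 {x = x} u v =
  ≐-trans (⊕-β u v ⟨ 𝟘 , x ⟩)
    (⌜⇒T⌝-cong p₀-pair (≐-trans (dN-equal N-𝟘 p₀-pair) (·-congʳ p₁-pair)))

⊕-at-1 : ∀ u v → Γ ⊢ (u ⊕ v) · ⟨ sN · 𝟘 , x ⟩ ≐ ⌜N sN · 𝟘 ⇒T v · x ⌝
⊕-at-1 {Γ} {x} u v =
  ≐-trans (⊕-β u v ⟨ sN · 𝟘 , x ⟩)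
    (⌜⇒T⌝-cong p₀-pair (≐-trans (dN-distinct N-index N-𝟘 index≢𝟘) (·-congʳ p₁-pair)))
  where
  N-index : Γ ⊢ N (p₀ · ⟨ sN · 𝟘 , x ⟩)
  N-index = N-subst (≐-sym p₀-pair) N-1
  index≢𝟘 : Γ ⊢ ¬' (p₀ · ⟨ sN · 𝟘 , x ⟩ ≐ 𝟘)
  index≢𝟘 = ≐-subst (¬' (var 0 ≐ 𝟘)) refl refl (≐-sym p₀-pair) 1≢𝟘

⊕-decided : ∀ {Γ} u v y → Γ ⊢ C u → Γ ⊢ C v → Γ ⊢ Decided ((u ⊕ v) · y)
⊕-decided {Γ} u v y hu hv =
  Decided-≐ (≐-sym (⊕-β u v y)) (by-cases (N (p₀ · y)) number non-number)
  where
  number : N (p₀ · y) ∷ Γ ⊢ Decided ⌜N p₀ · y ⇒T ⊕-select u v y ⌝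
  number = by-cases (p₀ · y ≐ 𝟘)
    (⌜⇒T⌝-decided (weaken (weaken hu)) (weaken assumption) (dN-equal N-𝟘 assumption))
    (⌜⇒T⌝-decided (weaken (weaken hv)) (weaken assumption)
                  (dN-distinct (weaken assumption) N-𝟘 assumption))
  -- Any universe makes the code of N c → T(d) true once N c fails; l u is one at hand.
  non-number : ¬' (N (p₀ · y)) ∷ Γ ⊢ Decided ⌜N p₀ · y ⇒T ⊕-select u v y ⌝
  non-number =
    ∨-introˡ (univ-sound (𝕝-universe u (weaken hu))
                         (univ-⇒T-vacuous (𝕝-universe u (weaken hu)) assumption))

⊕-classical : ∀ n → (C (var (suc n)) ∧' C (var n)) ∷ [] ⊢ C (var (suc n) ⊕ var n)
⊕-classical n =
  ∀-intro (⊕-decided (var (suc (suc n))) (var (suc n)) (var 0)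
                     (∧-elimˡ assumption) (∧-elimʳ assumption))

⊕-extendsˡ : (C (var 1) ∧' C (var 0)) ∷ [] ⊢ var 1 ⊏ 𝕝[ var 1 , var 0 ]
⊕-extendsˡ = ⊏-intro (var 1) 𝕝[ var 1 , var 0 ]
  (𝕝-extends-branch hu hw N-𝟘 (⊕-at-𝟘 (var 2) (var 1)) assumption)
  (𝕝-extends-¬branch hu hw N-𝟘 (⊕-at-𝟘 (var 2) (var 1)) assumption)
  where
  hu : A ∷ (C (var 2) ∧' C (var 1)) ∷ [] ⊢ C (var 2)
  hu = weaken (∧-elimˡ assumption)
  hw : A ∷ (C (var 2) ∧' C (var 1)) ∷ [] ⊢ C (var 2 ⊕ var 1)
  hw = weaken (⊕-classical 1)

⊕-extendsʳ : (C (var 1) ∧' C (var 0)) ∷ [] ⊢ var 0 ⊏ 𝕝[ var 1 , var 0 ]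
⊕-extendsʳ = ⊏-intro (var 0) 𝕝[ var 1 , var 0 ]
  (𝕝-extends-branch hv hw N-1 (⊕-at-1 (var 2) (var 1)) assumption)
  (𝕝-extends-¬branch hv hw N-1 (⊕-at-1 (var 2) (var 1)) assumption)
  where
  hv : A ∷ (C (var 2) ∧' C (var 1)) ∷ [] ⊢ C (var 1)
  hv = weaken (∧-elimʳ assumption)
  hw : A ∷ (C (var 2) ∧' C (var 1)) ∷ [] ⊢ C (var 2 ⊕ var 1)
  hw = weaken (⊕-classical 1)

lemma7p8 : Prf VFU (∀' (∀' (C (var 1) ∧' C (var 0) ⇒
             U 𝕝[ var 1 , var 0 ] ∧' (var 1 ⊏ 𝕝[ var 1 , var 0 ]) ∧' (var 0 ⊏ 𝕝[ var 1 , var 0 ]))))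
lemma7p8 =
  gen (gen (close (⇒-intro (∧-intro (𝕝-universe (var 1 ⊕ var 0) (⊕-classical 0))
                                    (∧-intro ⊕-extendsˡ ⊕-extendsʳ)))))
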